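{- As an identity of formal power series in $t$, $$\sum_{n \geq 0} t^n \sum_{v\in V(\mathcal{R}_n)}d^{\deg_{\rm down}(v)}z^{w(v)-\deg_{\rm down}(v)} = \frac{1+dt+(d-z)t^2+d(d-z)t^3+d(d-z)t^4}{1-t-zt^2-(d-z) t^3 -d(d-z)t^5}.$$
   Context: Binary strings and hypercube. For $n\ge 0$ let $\mathcal{B}_n$ be the set of binary strings of length $n$ (the only string of length $0$ is the empty string). The weight $w(u)$ of a binary string $u$ is its number of 1s. The hypercube $Q_n$ has vertex set $\mathcal{B}_n$, and two strings are adjacent iff they differ in exactly one position. Run-constrained strings. A run in a binary string is a maximal substring of equal bits. A binary string is run-constrained if every run of 1s is immediately followed by a strictly longer run of 0s. Fibonacci-run graph. $\mathcal{R}_n$ is the subgraph of $Q_n$ induced by $\{s\in\mathcal{B}_n: s00\text{ is run-constrained}\}$. Down-degree. For a vertex $v$ of an induced subgraph $G$ of $Q_n$, the down-degree $\deg_{\rm down}(v)$ is the number of neighbours of $v$ in $G$ obtained from $v$ by changing a single 1 into a 0. -}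

module Defs where

open import Data.Bool using (Bool; true; false; _∧_; if_then_else_)
open import Data.Nat as ℕ using (ℕ; zero; suc; _∸_)
open import Data.Product using (_×_; _,_)
open import Data.List using (List; []; _∷_; _++_; map; length; filter; foldr)
open import Data.Integer using (ℤ; _+_; _*_; _-_; -_; _^_; 0ℤ; 1ℤ)
open import Relation.Nullary.Decidable using (⌊_⌋)
open import Data.Bool.Properties using (T?)

-- Binary strings are lists of booleans (true = 1, false = 0).

B : ℕ → List (List Bool)
B zero    = [] ∷ []
B (suc n) = map (false ∷_) (B n) ++ map (true ∷_) (B n)

w : List Bool → ℕ
w []           = 0
w (true ∷ xs)  = suc (w xs)
w (false ∷ xs) = w xs

runs : List Bool → List (Bool × ℕ)
runs [] = []
runs (b ∷ xs) = add b (runs xs)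
  where
  sameBit : Bool → Bool → Bool
  sameBit true  true  = true
  sameBit false false = true
  sameBit _     _     = false
  add : Bool → List (Bool × ℕ) → List (Bool × ℕ)
  add b [] = (b , 1) ∷ []
  add b ((c , k) ∷ rs) = if sameBit b c then (c , suc k) ∷ rs
                                         else (b , 1) ∷ (c , k) ∷ rs

runsOK : List (Bool × ℕ) → Bool
runsOK [] = true
runsOK ((false , _) ∷ rs) = runsOK rs
runsOK ((true , k) ∷ []) = false
runsOK ((true , k) ∷ (true , _) ∷ rs) = false
runsOK ((true , k) ∷ (false , m) ∷ rs) = ⌊ k ℕ.<? m ⌋ ∧ runsOK ((false , m) ∷ rs)

runConstrained : List Bool → Bool
runConstrained s = runsOK (runs s)

-- vertex predicate of the Fibonacci-run graph: s00 is run-constrained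
inR : List Bool → Bool
inR s = runConstrained (s ++ false ∷ false ∷ [])

V : ℕ → List (List Bool)
V n = filter (λ s → T? (inR s)) (B n)

downFlips : List Bool → List (List Bool)
downFlips [] = []
downFlips (true ∷ xs)  = (false ∷ xs) ∷ map (true ∷_) (downFlips xs)
downFlips (false ∷ xs) = map (false ∷_) (downFlips xs)

degDown : List Bool → ℕ
degDown s = length (filter (λ u → T? (inR u)) (downFlips s))

Series : Set
Series = ℕ → ℤ

sumTo : ℕ → (ℕ → ℤ) → ℤ
sumTo zero    f = f 0
sumTo (suc n) f = sumTo n f + f (suc n)

_⋆_ : Series → Series → Series
(f ⋆ g) n = sumTo n (λ i → f i * g (n ∸ i))

-- polynomial (coefficient list, lowest degree first) as a series
poly : List ℤ → Series
poly [] _ = 0ℤ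
poly (c ∷ cs) zero = c
poly (c ∷ cs) (suc n) = poly cs n

coeff : ℤ → ℤ → Series
coeff d z n = foldr _+_ 0ℤ (map (λ v → (d ^ degDown v) * (z ^ (w v ∸ degDown v))) (V n))

numer : ℤ → ℤ → Series
numer d z = poly (1ℤ ∷ d ∷ (d - z) ∷ (d * (d - z)) ∷ (d * (d - z)) ∷ [])

denom : ℤ → ℤ → Series
denom d z = poly (1ℤ ∷ (- 1ℤ) ∷ (- z) ∷ (- (d - z)) ∷ 0ℤ ∷ (- (d * (d - z))) ∷ [])

-- Give s the weight d^deg(s) z^(w(s)−deg(s)) if s is a vertex of R and 0 otherwise. Membership is
-- decided block by block: in s00 a block 1^(k+1) 0^(j+1) followed by a 1 or by the end is admissible
-- iff j > k, and an admissible block can be deleted. Flipping an interior 1 of a run of 1s leaves an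
-- inadmissible 1^a 0 1, so only the first and the last 1 of a run can flip down. Hence a leading 0
-- changes nothing, blocks with a too short 0-run weigh 0, the blocks 100 and 11000 contribute factors
-- d and d², and 1^(m+3) 0^(j+2) has the same membership and down-degree as 1^(m+2) 0^(j+1) but one
-- more 1, i.e. an extra factor z. Sorting strings by their leading block gives recursions for the
-- total weights F n of B n and G k n, H k n of the strings 1^(k+1) s and 1^(k+1) 0 s; eliminating G
-- gives F(n+5) = F(n+4) + z F(n+3) + (d−z) F(n+2) + d(d−z) F(n), which with F 0, …, F 4 is the
-- coefficientwise form of the identity.

module Submission where

open import Defs
open import Data.Bool using (Bool; true; false; _∧_; if_then_else_; T)
open import Data.Bool.Properties using (T?)
open import Data.Nat as ℕ using (ℕ; zero; suc; _∸_; _≤_; _<_; z≤n; s≤s; _<?_)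
open import Data.Nat.Properties using (≤-refl; ≤⇒≯; m≤n⇒m≤1+n; m≤n⇒m≤n+o; +-∸-assoc; n∸n≡0)
import Data.Nat.Properties as ℕ using (+-comm)
open import Data.Product using (_,_)
open import Data.List using (List; []; _∷_; _++_; map; length; filter; foldr; replicate)
open import Data.List.Properties using (++-assoc; length-map; length-filter; filter-≐; map-++; map-∘)
open import Data.Integer using (ℤ; _+_; _*_; _-_; -_; _^_; 0ℤ; 1ℤ)
open import Data.Integer.Properties
  using (+-identityˡ; +-identityʳ; +-assoc; *-identityʳ; *-zeroʳ; *-assoc; *-distribˡ-+; *-commutativeSemigroup)
open import Data.Integer.Tactic.RingSolver using (solve)
open import Algebra.Properties.CommutativeSemigroup *-commutativeSemigroup using (x∙yz≈y∙xz)
open import Relation.Nullary.Decidable using (does; isYes≗does; dec-true; dec-false)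
open import Relation.Binary.PropositionalEquality using (_≡_; refl; sym; trans; cong; cong₂; subst; module ≡-Reasoning)
open ≡-Reasoning

ones zeros : ℕ → List Bool
ones k  = replicate k true
zeros j = replicate j false

zeros-++-zeros : ∀ i j y → zeros i ++ zeros j ++ y ≡ zeros (i ℕ.+ j) ++ y
zeros-++-zeros zero    j y = refl
zeros-++-zeros (suc i) j y = cong (false ∷_) (zeros-++-zeros i j y)

ones-++-true∷ : ∀ k s → ones k ++ true ∷ s ≡ ones (suc k) ++ s
ones-++-true∷ zero    s = refl
ones-++-true∷ (suc k) s = cong (true ∷_) (ones-++-true∷ k s)

w-++-false∷ : ∀ xs ys → w (xs ++ false ∷ ys) ≡ w (xs ++ ys)
w-++-false∷ []           ys = refl
w-++-false∷ (true ∷ xs)  ys = cong suc (w-++-false∷ xs ys)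
w-++-false∷ (false ∷ xs) ys = w-++-false∷ xs ys

data NoLeadingZero : List Bool → Set where
  empty : NoLeadingZero []
  one∷  : ∀ xs → NoLeadingZero (true ∷ xs)

runs-zeros : ∀ j {y} → NoLeadingZero y → runs (zeros (suc j) ++ y) ≡ (false , suc j) ∷ runs y
runs-zeros zero    empty     = refl
runs-zeros zero    (one∷ xs) with runs xs
... | []              = refl
... | (true  , _) ∷ _ = refl
... | (false , _) ∷ _ = refl
runs-zeros (suc j) p rewrite runs-zeros j p = refl

runs-ones : ∀ k x → runs (ones (suc k) ++ false ∷ x) ≡ (true , suc k) ∷ runs (false ∷ x)
runs-ones zero    x with runs x
... | []              = refl
... | (true  , _) ∷ _ = refl
... | (false , _) ∷ _ = refl
runs-ones (suc k) x rewrite runs-ones k x = refl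

runConstrained-false∷ : ∀ x → runConstrained (false ∷ x) ≡ runConstrained x
runConstrained-false∷ x with runs x
... | []              = refl
... | (true  , _) ∷ _ = refl
... | (false , _) ∷ _ = refl

runConstrained-zeros : ∀ i y → runConstrained (zeros i ++ y) ≡ runConstrained y
runConstrained-zeros zero    y = refl
runConstrained-zeros (suc i) y = trans (runConstrained-false∷ (zeros i ++ y)) (runConstrained-zeros i y)

runConstrained-block : ∀ k j {y} → NoLeadingZero y →
  runConstrained (ones (suc k) ++ zeros (suc j) ++ y) ≡ does (k <? j) ∧ runConstrained y
runConstrained-block k j {y} p = begin
  runsOK (runs (ones (suc k) ++ zeros (suc j) ++ y))
    ≡⟨ cong runsOK (trans (runs-ones k (zeros j ++ y)) (cong ((true , suc k) ∷_) (runs-zeros j p))) ⟩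
  runsOK ((true , suc k) ∷ (false , suc j) ∷ runs y)
    ≡⟨ cong (_∧ runConstrained y) (isYes≗does (suc k <? suc j)) ⟩
  does (k <? j) ∧ runConstrained y ∎

data ZerosView : List Bool → Set where
  zeros-++ : ∀ i {y} → NoLeadingZero y → ZerosView (zeros i ++ y)

zerosView : ∀ x → ZerosView x
zerosView []          = zeros-++ 0 empty
zerosView (true ∷ x)  = zeros-++ 0 (one∷ x)
zerosView (false ∷ x) with zerosView x
... | zeros-++ i p = zeros-++ (suc i) p

runConstrained-block-zeros : ∀ k j i {y} → NoLeadingZero y →
  runConstrained (ones (suc k) ++ zeros (suc j) ++ zeros i ++ y) ≡ does (k <? j ℕ.+ i) ∧ runConstrained y
runConstrained-block-zeros k j i {y} p =
  trans (cong (λ t → runConstrained (ones (suc k) ++ t)) (zeros-++-zeros (suc j) i y))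
        (runConstrained-block k (j ℕ.+ i) p)

runConstrained-block-shift : ∀ k j x →
  runConstrained (ones (suc k) ++ zeros (suc j) ++ x) ≡ runConstrained (ones (suc (suc k)) ++ zeros (suc (suc j)) ++ x)
runConstrained-block-shift k j x with zerosView x
... | zeros-++ i p = trans (runConstrained-block-zeros k j i p) (sym (runConstrained-block-zeros (suc k) (suc j) i p))

runConstrained-block-drop : ∀ {k j} x → k < j → runConstrained (ones (suc k) ++ zeros (suc j) ++ x) ≡ runConstrained x
runConstrained-block-drop {k} {j} x k<j with zerosView x
... | zeros-++ i {y} p = begin
  runConstrained (ones (suc k) ++ zeros (suc j) ++ zeros i ++ y)
    ≡⟨ runConstrained-block-zeros k j i p ⟩
  does (k <? j ℕ.+ i) ∧ runConstrained y
    ≡⟨ cong (_∧ runConstrained y) (dec-true (k <? j ℕ.+ i) (m≤n⇒m≤n+o i k<j)) ⟩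
  runConstrained y
    ≡⟨ sym (runConstrained-zeros i y) ⟩
  runConstrained (zeros i ++ y) ∎

inR-false∷ : ∀ s → inR (false ∷ s) ≡ inR s
inR-false∷ s = runConstrained-false∷ (s ++ zeros 2)

inR-zeros : ∀ i s → inR (zeros i ++ s) ≡ inR s
inR-zeros zero    s = refl
inR-zeros (suc i) s = trans (inR-false∷ (zeros i ++ s)) (inR-zeros i s)

inR-block : ∀ k j s →
  inR (ones (suc k) ++ zeros (suc j) ++ s) ≡ runConstrained (ones (suc k) ++ zeros (suc j) ++ s ++ zeros 2)
inR-block k j s = cong runConstrained
  (trans (++-assoc (ones (suc k)) (zeros (suc j) ++ s) (zeros 2))
         (cong (ones (suc k) ++_) (++-assoc (zeros (suc j)) s (zeros 2))))

inR-block-shift : ∀ k j s →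
  inR (ones (suc k) ++ zeros (suc j) ++ s) ≡ inR (ones (suc (suc k)) ++ zeros (suc (suc j)) ++ s)
inR-block-shift k j s =
  trans (inR-block k j s) (trans (runConstrained-block-shift k j (s ++ zeros 2)) (sym (inR-block (suc k) (suc j) s)))

inR-block-drop : ∀ k j s → k < j → inR (ones (suc k) ++ zeros (suc j) ++ s) ≡ inR s
inR-block-drop k j s k<j = trans (inR-block k j s) (runConstrained-block-drop (s ++ zeros 2) k<j)

inR-short-block : ∀ k j s → j ≤ k → inR (ones (suc k) ++ zeros (suc j) ++ true ∷ s) ≡ false
inR-short-block k j s j≤k = begin
  inR (ones (suc k) ++ zeros (suc j) ++ true ∷ s)
    ≡⟨ inR-block k j (true ∷ s) ⟩
  runConstrained (ones (suc k) ++ zeros (suc j) ++ true ∷ s ++ zeros 2)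
    ≡⟨ runConstrained-block k j (one∷ (s ++ zeros 2)) ⟩
  does (k <? j) ∧ inR (true ∷ s)
    ≡⟨ cong (_∧ inR (true ∷ s)) (dec-false (k <? j) (≤⇒≯ j≤k)) ⟩
  false ∎

inR-short-suffix : ∀ {k j} → j < k → inR (ones (suc k) ++ zeros j) ≡ false
inR-short-suffix {k} {j} j<k = begin
  runConstrained ((ones (suc k) ++ zeros j) ++ zeros 2)
    ≡⟨ cong runConstrained (++-assoc (ones (suc k)) (zeros j) (zeros 2)) ⟩
  runConstrained (ones (suc k) ++ zeros j ++ zeros 2 ++ [])
    ≡⟨ cong (λ t → runConstrained (ones (suc k) ++ t))
            (trans (zeros-++-zeros j 2 []) (cong (λ i → zeros i ++ []) (ℕ.+-comm j 2))) ⟩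
  runConstrained (ones (suc k) ++ zeros (suc (suc j)) ++ [])
    ≡⟨ runConstrained-block k (suc j) empty ⟩
  does (k <? suc j) ∧ true
    ≡⟨ cong (_∧ true) (dec-false (k <? suc j) (≤⇒≯ j<k)) ⟩
  false ∎

indicator : Bool → ℕ
indicator b = if b then 1 else 0

countDown : (List Bool → Bool) → List Bool → ℕ
countDown P s = length (filter (λ u → T? (P u)) (downFlips s))

length-filter-map : ∀ {A B : Set} (P : B → Bool) (f : A → B) xs →
  length (filter (λ u → T? (P u)) (map f xs)) ≡ length (filter (λ u → T? (P (f u))) xs)
length-filter-map P f []       = refl
length-filter-map P f (x ∷ xs) with P (f x)
... | true  = cong suc (length-filter-map P f xs)
... | false = length-filter-map P f xs

length-downFlips : ∀ s → length (downFlips s) ≡ w s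
length-downFlips []          = refl
length-downFlips (true ∷ s)  = cong suc (trans (length-map (true ∷_) (downFlips s)) (length-downFlips s))
length-downFlips (false ∷ s) = trans (length-map (false ∷_) (downFlips s)) (length-downFlips s)

countDown≤w : ∀ P s → countDown P s ≤ w s
countDown≤w P s = subst (countDown P s ≤_) (length-downFlips s) (length-filter (λ u → T? (P u)) (downFlips s))

countDown-cong : ∀ {P Q} s → (∀ u → P u ≡ Q u) → countDown P s ≡ countDown Q s
countDown-cong {P} {Q} s P≗Q = cong length
  (filter-≐ (λ u → T? (P u)) (λ u → T? (Q u)) ((λ {u} → subst T (P≗Q u)) , (λ {u} → subst T (sym (P≗Q u)))) (downFlips s))

countDown-false∷ : ∀ P s → countDown P (false ∷ s) ≡ countDown (λ u → P (false ∷ u)) s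
countDown-false∷ P s = length-filter-map P (false ∷_) (downFlips s)

countDown-true∷ : ∀ P s → countDown P (true ∷ s) ≡ indicator (P (false ∷ s)) ℕ.+ countDown (λ u → P (true ∷ u)) s
countDown-true∷ P s with P (false ∷ s)
... | true  = cong suc (length-filter-map P (true ∷_) (downFlips s))
... | false = length-filter-map P (true ∷_) (downFlips s)

countDown-zeros : ∀ P j s → countDown P (zeros j ++ s) ≡ countDown (λ u → P (zeros j ++ u)) s
countDown-zeros P zero    s = refl
countDown-zeros P (suc j) s = trans (countDown-false∷ P (zeros j ++ s)) (countDown-zeros (λ u → P (false ∷ u)) j s)

countDown-ones : ∀ P k x → (∀ a b → P (ones a ++ false ∷ ones (suc b) ++ x) ≡ false) →
  countDown P (ones (suc k) ++ x) ≡ indicator (P (ones k ++ false ∷ x)) ℕ.+ countDown (λ u → P (ones (suc k) ++ u)) x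
countDown-ones P zero    x _        = countDown-true∷ P x
countDown-ones P (suc k) x rejected = begin
  countDown P (true ∷ ones (suc k) ++ x)
    ≡⟨ countDown-true∷ P (ones (suc k) ++ x) ⟩
  indicator (P (false ∷ ones (suc k) ++ x)) ℕ.+ countDown (λ u → P (true ∷ u)) (ones (suc k) ++ x)
    ≡⟨ cong₂ ℕ._+_ (cong indicator (rejected 0 k)) (countDown-ones (λ u → P (true ∷ u)) k x (λ a → rejected (suc a))) ⟩
  indicator (P (ones (suc k) ++ false ∷ x)) ℕ.+ countDown (λ u → P (ones (suc (suc k)) ++ u)) x ∎

degDown-false∷ : ∀ s → degDown (false ∷ s) ≡ degDown s
degDown-false∷ s = trans (countDown-false∷ inR s) (countDown-cong s inR-false∷)

degDown-ones : ∀ k x → degDown (ones (suc (suc k)) ++ x) ≡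
  indicator (inR (false ∷ ones (suc k) ++ x)) ℕ.+
  (indicator (inR (ones (suc k) ++ false ∷ x)) ℕ.+ countDown (λ u → inR (ones (suc (suc k)) ++ u)) x)
degDown-ones k x = trans (countDown-true∷ inR (ones (suc k) ++ x))
  (cong (indicator (inR (false ∷ ones (suc k) ++ x)) ℕ.+_)
        (countDown-ones (λ u → inR (true ∷ u)) k x (λ a b → inR-short-block a 0 (ones b ++ x) z≤n)))

degDown-100 : ∀ s → degDown (ones 1 ++ zeros 2 ++ s) ≡ indicator (inR s) ℕ.+ degDown s
degDown-100 s = begin
  degDown (ones 1 ++ zeros 2 ++ s)
    ≡⟨ countDown-true∷ inR (zeros 2 ++ s) ⟩
  indicator (inR (zeros 3 ++ s)) ℕ.+ countDown (λ u → inR (true ∷ u)) (zeros 2 ++ s)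
    ≡⟨ cong₂ ℕ._+_ (cong indicator (inR-zeros 3 s))
                   (trans (countDown-zeros (λ u → inR (true ∷ u)) 2 s)
                          (countDown-cong s (λ u → inR-block-drop 0 1 u (s≤s z≤n)))) ⟩
  indicator (inR s) ℕ.+ degDown s ∎

degDown-11000 : ∀ s → degDown (ones 2 ++ zeros 3 ++ s) ≡ indicator (inR s) ℕ.+ (indicator (inR s) ℕ.+ degDown s)
degDown-11000 s = trans (degDown-ones 0 (zeros 3 ++ s))
  (cong₂ ℕ._+_ (cong indicator (trans (inR-false∷ (ones 1 ++ zeros 3 ++ s)) (inR-block-drop 0 2 s (s≤s z≤n))))
    (cong₂ ℕ._+_ (cong indicator (inR-block-drop 0 3 s (s≤s z≤n)))
      (trans (countDown-zeros (λ u → inR (ones 2 ++ u)) 3 s)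
             (countDown-cong s (λ u → inR-block-drop 1 2 u (s≤s (s≤s z≤n)))))))

degDown-block-shift : ∀ m j x →
  degDown (ones (3 ℕ.+ m) ++ zeros (2 ℕ.+ j) ++ x) ≡ degDown (ones (2 ℕ.+ m) ++ zeros (1 ℕ.+ j) ++ x)
degDown-block-shift m j x = begin
  degDown (ones (3 ℕ.+ m) ++ zeros (2 ℕ.+ j) ++ x)
    ≡⟨ degDown-ones (suc m) (zeros (2 ℕ.+ j) ++ x) ⟩
  indicator (inR (false ∷ ones (2 ℕ.+ m) ++ zeros (2 ℕ.+ j) ++ x)) ℕ.+
  (indicator (inR (ones (2 ℕ.+ m) ++ zeros (3 ℕ.+ j) ++ x)) ℕ.+
   countDown (λ u → inR (ones (3 ℕ.+ m) ++ u)) (zeros (2 ℕ.+ j) ++ x))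
    ≡⟨ cong₂ ℕ._+_ (cong indicator first) (cong₂ ℕ._+_ (cong indicator (sym (inR-block-shift m (suc j) x))) rest) ⟩
  indicator (inR (false ∷ ones (1 ℕ.+ m) ++ zeros (1 ℕ.+ j) ++ x)) ℕ.+
  (indicator (inR (ones (1 ℕ.+ m) ++ zeros (2 ℕ.+ j) ++ x)) ℕ.+
   countDown (λ u → inR (ones (2 ℕ.+ m) ++ u)) (zeros (1 ℕ.+ j) ++ x))
    ≡⟨ sym (degDown-ones m (zeros (1 ℕ.+ j) ++ x)) ⟩
  degDown (ones (2 ℕ.+ m) ++ zeros (1 ℕ.+ j) ++ x) ∎
  where
  first : inR (false ∷ ones (2 ℕ.+ m) ++ zeros (2 ℕ.+ j) ++ x) ≡ inR (false ∷ ones (1 ℕ.+ m) ++ zeros (1 ℕ.+ j) ++ x)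
  first = trans (inR-false∷ (ones (2 ℕ.+ m) ++ zeros (2 ℕ.+ j) ++ x))
          (trans (sym (inR-block-shift m j x)) (sym (inR-false∷ (ones (1 ℕ.+ m) ++ zeros (1 ℕ.+ j) ++ x))))
  rest : countDown (λ u → inR (ones (3 ℕ.+ m) ++ u)) (zeros (2 ℕ.+ j) ++ x) ≡
         countDown (λ u → inR (ones (2 ℕ.+ m) ++ u)) (zeros (1 ℕ.+ j) ++ x)
  rest = trans (countDown-zeros _ (2 ℕ.+ j) x)
        (trans (countDown-cong x (λ u → sym (inR-block-shift (suc m) j u))) (sym (countDown-zeros _ (1 ℕ.+ j) x)))

sumStrings : ℕ → (List Bool → ℤ) → ℤ
sumStrings zero    f = f []
sumStrings (suc n) f = sumStrings n (λ s → f (false ∷ s)) + sumStrings n (λ s → f (true ∷ s))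

sumStrings-cong : ∀ n {f g} → (∀ s → f s ≡ g s) → sumStrings n f ≡ sumStrings n g
sumStrings-cong zero    f≗g = f≗g []
sumStrings-cong (suc n) f≗g =
  cong₂ _+_ (sumStrings-cong n (λ s → f≗g (false ∷ s))) (sumStrings-cong n (λ s → f≗g (true ∷ s)))

sumStrings-zero : ∀ n {f} → (∀ s → f s ≡ 0ℤ) → sumStrings n f ≡ 0ℤ
sumStrings-zero zero    f≗0 = f≗0 []
sumStrings-zero (suc n) f≗0 =
  cong₂ _+_ (sumStrings-zero n (λ s → f≗0 (false ∷ s))) (sumStrings-zero n (λ s → f≗0 (true ∷ s)))

sumStrings-scale : ∀ n c f → sumStrings n (λ s → c * f s) ≡ c * sumStrings n f
sumStrings-scale zero    c f = refl
sumStrings-scale (suc n) c f =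
  trans (cong₂ _+_ (sumStrings-scale n c _) (sumStrings-scale n c _)) (sym (*-distribˡ-+ c _ _))

sum : List ℤ → ℤ
sum = foldr _+_ 0ℤ

sum-++ : ∀ xs ys → sum (xs ++ ys) ≡ sum xs + sum ys
sum-++ []       ys = sym (+-identityˡ (sum ys))
sum-++ (x ∷ xs) ys = trans (cong (x +_) (sum-++ xs ys)) (sym (+-assoc x (sum xs) (sum ys)))

sum-map-filter : ∀ {A : Set} (P : A → Bool) (g : A → ℤ) xs →
  sum (map g (filter (λ x → T? (P x)) xs)) ≡ sum (map (λ x → if P x then g x else 0ℤ) xs)
sum-map-filter P g []       = refl
sum-map-filter P g (x ∷ xs) with P x
... | true  = cong (g x +_) (sum-map-filter P g xs)
... | false = trans (sum-map-filter P g xs) (sym (+-identityˡ _))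

sum-map-B : ∀ n f → sum (map f (B n)) ≡ sumStrings n f
sum-map-B zero    f = +-identityʳ (f [])
sum-map-B (suc n) f = begin
  sum (map f (map (false ∷_) (B n) ++ map (true ∷_) (B n)))
    ≡⟨ cong sum (map-++ f (map (false ∷_) (B n)) (map (true ∷_) (B n))) ⟩
  sum (map f (map (false ∷_) (B n)) ++ map f (map (true ∷_) (B n)))
    ≡⟨ sum-++ (map f (map (false ∷_) (B n))) (map f (map (true ∷_) (B n))) ⟩
  sum (map f (map (false ∷_) (B n))) + sum (map f (map (true ∷_) (B n)))
    ≡⟨ cong₂ _+_ (trans (cong sum (sym (map-∘ (B n)))) (sum-map-B n _))
                 (trans (cong sum (sym (map-∘ (B n)))) (sum-map-B n _)) ⟩
  sumStrings (suc n) f ∎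

module WeightedCount (d z : ℤ) where

  term : Bool → ℕ → ℕ → ℤ
  term b D W = if b then d ^ D * z ^ (W ∸ D) else 0ℤ

  weight : List Bool → ℤ
  weight s = term (inR s) (degDown s) (w s)

  coeff≡sumStrings : ∀ n → coeff d z n ≡ sumStrings n weight
  coeff≡sumStrings n =
    trans (sum-map-filter inR (λ v → d ^ degDown v * z ^ (w v ∸ degDown v)) (B n)) (sum-map-B n weight)

  term-d : ∀ b D W → term b (indicator b ℕ.+ D) (suc W) ≡ d * term b D W
  term-d true  D W = *-assoc d (d ^ D) (z ^ (W ∸ D))
  term-d false D W = sym (*-zeroʳ d)

  term-z : ∀ b D W → D ≤ W → term b D (suc W) ≡ z * term b D W
  term-z true  D W D≤W = begin
    d ^ D * z ^ (suc W ∸ D)    ≡⟨ cong (λ e → d ^ D * z ^ e) (+-∸-assoc 1 D≤W) ⟩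
    d ^ D * (z * z ^ (W ∸ D))  ≡⟨ x∙yz≈y∙xz (d ^ D) z (z ^ (W ∸ D)) ⟩
    z * (d ^ D * z ^ (W ∸ D))  ∎
  term-z false D W _   = sym (*-zeroʳ z)

  weight-≡ : ∀ s {b D W} → inR s ≡ b → degDown s ≡ D → w s ≡ W → weight s ≡ term b D W
  weight-≡ s refl refl refl = refl

  weight-false∷ : ∀ s → weight (false ∷ s) ≡ weight s
  weight-false∷ s = weight-≡ (false ∷ s) (inR-false∷ s) (degDown-false∷ s) refl

  weight-short-block : ∀ k j s → j ≤ k → weight (ones (suc k) ++ zeros (suc j) ++ true ∷ s) ≡ 0ℤ
  weight-short-block k j s j≤k =
    weight-≡ (ones (suc k) ++ zeros (suc j) ++ true ∷ s) (inR-short-block k j s j≤k) refl refl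

  weight-short-suffix : ∀ k j → j < k → weight (ones (suc k) ++ zeros j) ≡ 0ℤ
  weight-short-suffix k j j<k = weight-≡ (ones (suc k) ++ zeros j) (inR-short-suffix j<k) refl refl

  weight-100 : ∀ s → weight (ones 1 ++ zeros 2 ++ s) ≡ d * weight s
  weight-100 s = trans (weight-≡ (ones 1 ++ zeros 2 ++ s) (inR-block-drop 0 1 s (s≤s z≤n)) (degDown-100 s) refl)
                       (term-d (inR s) (degDown s) (w s))

  weight-11000 : ∀ s → weight (ones 2 ++ zeros 3 ++ s) ≡ d * (d * weight s)
  weight-11000 s = trans (weight-≡ (ones 2 ++ zeros 3 ++ s) (inR-block-drop 1 2 s (s≤s (s≤s z≤n))) (degDown-11000 s) refl)
    (trans (term-d (inR s) (indicator (inR s) ℕ.+ degDown s) (suc (w s))) (cong (d *_) (term-d (inR s) (degDown s) (w s))))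

  weight-block-shift : ∀ m j x →
    weight (ones (3 ℕ.+ m) ++ zeros (2 ℕ.+ j) ++ x) ≡ z * weight (ones (2 ℕ.+ m) ++ zeros (1 ℕ.+ j) ++ x)
  weight-block-shift m j x = trans
    (weight-≡ (ones (3 ℕ.+ m) ++ zeros (2 ℕ.+ j) ++ x) (sym (inR-block-shift (suc m) j x)) (degDown-block-shift m j x)
              (cong suc (w-++-false∷ (ones (2 ℕ.+ m)) (zeros (1 ℕ.+ j) ++ x))))
    (term-z (inR s) (degDown s) (w s) (countDown≤w inR s))
    where s = ones (2 ℕ.+ m) ++ zeros (1 ℕ.+ j) ++ x

  F : ℕ → ℤ
  F n = sumStrings n weight

  G H : ℕ → ℕ → ℤ
  G k n = sumStrings n (λ s → weight (ones (suc k) ++ s))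
  H k n = sumStrings n (λ s → weight (ones (suc k) ++ false ∷ s))

  F-suc : ∀ n → F (suc n) ≡ F n + G 0 n
  F-suc n = cong (_+ G 0 n) (sumStrings-cong n weight-false∷)

  G-suc : ∀ k n → G k (suc n) ≡ H k n + G (suc k) n
  G-suc k n = cong (H k n +_) (sumStrings-cong n (λ s → cong weight (ones-++-true∷ (suc k) s)))

  H0-suc : ∀ n → H 0 (suc n) ≡ d * F n
  H0-suc n = begin
    sumStrings n (λ s → weight (ones 1 ++ zeros 2 ++ s)) + sumStrings n (λ s → weight (ones 1 ++ zeros 1 ++ true ∷ s))
      ≡⟨ cong₂ _+_ (trans (sumStrings-cong n weight-100) (sumStrings-scale n d weight))
                   (sumStrings-zero n (λ s → weight-short-block 0 0 s z≤n)) ⟩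
    d * F n + 0ℤ
      ≡⟨ +-identityʳ (d * F n) ⟩
    d * F n ∎

  H1-suc-suc : ∀ n → H 1 (2 ℕ.+ n) ≡ d * (d * F n)
  H1-suc-suc n = begin
    (sumStrings n (λ s → weight (ones 2 ++ zeros 3 ++ s)) + sumStrings n (λ s → weight (ones 2 ++ zeros 2 ++ true ∷ s)))
      + sumStrings (suc n) (λ s → weight (ones 2 ++ zeros 1 ++ true ∷ s))
      ≡⟨ cong₂ _+_ (cong₂ _+_ (trans (sumStrings-cong n weight-11000)
                                     (trans (sumStrings-scale n d _) (cong (d *_) (sumStrings-scale n d weight))))
                              (sumStrings-zero n (λ s → weight-short-block 1 1 s (s≤s z≤n))))
                   (sumStrings-zero (suc n) (λ s → weight-short-block 1 0 s z≤n)) ⟩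
    (d * (d * F n) + 0ℤ) + 0ℤ
      ≡⟨ trans (+-identityʳ _) (+-identityʳ _) ⟩
    d * (d * F n) ∎

  H-shift : ∀ m n → H (2 ℕ.+ m) (suc n) ≡ z * H (1 ℕ.+ m) n
  H-shift m n = begin
    sumStrings n (λ s → weight (ones (3 ℕ.+ m) ++ zeros 2 ++ s))
      + sumStrings n (λ s → weight (ones (3 ℕ.+ m) ++ zeros 1 ++ true ∷ s))
      ≡⟨ cong₂ _+_ (trans (sumStrings-cong n (weight-block-shift m 0)) (sumStrings-scale n z _))
                   (sumStrings-zero n (λ s → weight-short-block (2 ℕ.+ m) 0 s z≤n)) ⟩
    z * H (1 ℕ.+ m) n + 0ℤ
      ≡⟨ +-identityʳ _ ⟩
    z * H (1 ℕ.+ m) n ∎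

  G-shift : ∀ m n → G (2 ℕ.+ m) (suc n) ≡ z * G (1 ℕ.+ m) n
  G-shift m zero = begin
    G (2 ℕ.+ m) 1                                       ≡⟨ G-suc (2 ℕ.+ m) 0 ⟩
    H (2 ℕ.+ m) 0 + G (3 ℕ.+ m) 0                         ≡⟨ cong₂ _+_ (weight-short-suffix (2 ℕ.+ m) 1 (s≤s (s≤s z≤n)))
                                                                   (weight-short-suffix (3 ℕ.+ m) 0 (s≤s z≤n)) ⟩
    0ℤ                                                  ≡⟨ sym (*-zeroʳ z) ⟩
    z * 0ℤ                                              ≡⟨ cong (z *_) (sym (weight-short-suffix (1 ℕ.+ m) 0 (s≤s z≤n))) ⟩
    z * G (1 ℕ.+ m) 0                                     ∎
  G-shift m (suc n) = begin
    G (2 ℕ.+ m) (2 ℕ.+ n)                   ≡⟨ G-suc (2 ℕ.+ m) (suc n) ⟩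
    H (2 ℕ.+ m) (suc n) + G (3 ℕ.+ m) (suc n) ≡⟨ cong₂ _+_ (H-shift m n) (G-shift (suc m) n) ⟩
    z * H (1 ℕ.+ m) n + z * G (2 ℕ.+ m) n     ≡⟨ sym (*-distribˡ-+ z _ _) ⟩
    z * (H (1 ℕ.+ m) n + G (2 ℕ.+ m) n)       ≡⟨ cong (z *_) (sym (G-suc (1 ℕ.+ m) n)) ⟩
    z * G (1 ℕ.+ m) (suc n)                 ∎

  G0-suc-suc : ∀ n → G 0 (2 ℕ.+ n) ≡ d * F n + G 1 (1 ℕ.+ n)
  G0-suc-suc n = trans (G-suc 0 (suc n)) (cong (_+ G 1 (suc n)) (H0-suc n))

  G1-suc-suc-suc : ∀ n → G 1 (3 ℕ.+ n) ≡ d * (d * F n) + z * G 1 (1 ℕ.+ n)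
  G1-suc-suc-suc n = trans (G-suc 1 (2 ℕ.+ n)) (cong₂ _+_ (H1-suc-suc n) (G-shift 0 (suc n)))

  F-recurrence : ∀ n → F (5 ℕ.+ n) ≡ F (4 ℕ.+ n) + z * F (3 ℕ.+ n) + (d - z) * F (2 ℕ.+ n) + d * (d - z) * F n
  F-recurrence n = eliminate (F n) (F (2 ℕ.+ n)) (F (3 ℕ.+ n)) (F (4 ℕ.+ n)) (F (5 ℕ.+ n)) (G 1 (1 ℕ.+ n)) F₃ F₅
    where
    F₃ : F (3 ℕ.+ n) ≡ F (2 ℕ.+ n) + (d * F n + G 1 (1 ℕ.+ n))
    F₃ = trans (F-suc (2 ℕ.+ n)) (cong (F (2 ℕ.+ n) +_) (G0-suc-suc n))
    F₅ : F (5 ℕ.+ n) ≡ F (4 ℕ.+ n) + (d * F (2 ℕ.+ n) + (d * (d * F n) + z * G 1 (1 ℕ.+ n)))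
    F₅ = trans (F-suc (4 ℕ.+ n))
               (cong (F (4 ℕ.+ n) +_) (trans (G0-suc-suc (2 ℕ.+ n)) (cong (d * F (2 ℕ.+ n) +_) (G1-suc-suc-suc n))))
    eliminate : ∀ f₀ f₂ f₃ f₄ f₅ g → f₃ ≡ f₂ + (d * f₀ + g) → f₅ ≡ f₄ + (d * f₂ + (d * (d * f₀) + z * g)) →
                f₅ ≡ f₄ + z * f₃ + (d - z) * f₂ + d * (d - z) * f₀
    eliminate f₀ f₂ _ f₄ _ g refl refl = solve (d ∷ z ∷ f₀ ∷ f₂ ∷ f₄ ∷ g ∷ [])

  -- The weights of the short strings 1, 10, 110 and 1100 evaluate to these monomials.
  d¹z⁰ : d ^ 1 * z ^ 0 ≡ d
  d¹z⁰ = trans (*-identityʳ (d ^ 1)) (*-identityʳ d)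

  d²z⁰ : d ^ 2 * z ^ 0 ≡ d * d
  d²z⁰ = trans (*-identityʳ (d ^ 2)) (cong (d *_) (*-identityʳ d))

  F-1 : F 1 ≡ F 0 + d
  F-1 = trans (F-suc 0) (cong (F 0 +_) d¹z⁰)

  F-2 : F 2 ≡ F 1 + d
  F-2 = trans (F-suc 1) (cong (F 1 +_) (begin
    G 0 1          ≡⟨ G-suc 0 0 ⟩
    H 0 0 + G 1 0  ≡⟨ cong₂ _+_ d¹z⁰ (weight-short-suffix 1 0 (s≤s z≤n)) ⟩
    d + 0ℤ         ≡⟨ +-identityʳ d ⟩
    d              ∎))

  F-3 : F 3 ≡ F 2 + (d * F 0 + d * d)
  F-3 = trans (F-suc 2) (cong (F 2 +_) (trans (G0-suc-suc 0) (cong (d * F 0 +_) (begin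
    G 1 1          ≡⟨ G-suc 1 0 ⟩
    H 1 0 + G 2 0  ≡⟨ cong₂ _+_ d²z⁰ (weight-short-suffix 2 0 (s≤s z≤n)) ⟩
    d * d + 0ℤ     ≡⟨ +-identityʳ (d * d) ⟩
    d * d          ∎))))

  F-4 : F 4 ≡ F 3 + (d * F 1 + d * d)
  F-4 = trans (F-suc 3) (cong (F 3 +_) (trans (G0-suc-suc 1) (cong (d * F 1 +_) (begin
    G 1 2                  ≡⟨ G-suc 1 1 ⟩
    H 1 1 + G 2 1          ≡⟨ cong₂ _+_ (cong₂ _+_ d²z⁰ (weight-short-block 1 1 [] (s≤s z≤n))) (G-shift 0 0) ⟩
    (d * d + 0ℤ) + z * G 1 0 ≡⟨ cong₂ _+_ (+-identityʳ (d * d))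
                                        (trans (cong (z *_) (weight-short-suffix 1 0 (s≤s z≤n))) (*-zeroʳ z)) ⟩
    d * d + 0ℤ             ≡⟨ +-identityʳ (d * d) ⟩
    d * d                  ∎))))

sumTo-cong : ∀ n {f g} → (∀ i → i ≤ n → f i ≡ g i) → sumTo n f ≡ sumTo n g
sumTo-cong zero    f≗g = f≗g 0 z≤n
sumTo-cong (suc n) f≗g = cong₂ _+_ (sumTo-cong n (λ i i≤n → f≗g i (m≤n⇒m≤1+n i≤n))) (f≗g (suc n) ≤-refl)

sumTo-zero : ∀ n {f} → (∀ i → f i ≡ 0ℤ) → sumTo n f ≡ 0ℤ
sumTo-zero zero    f≗0 = f≗0 0
sumTo-zero (suc n) f≗0 = cong₂ _+_ (sumTo-zero n f≗0) (f≗0 (suc n))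

⋆-congˡ : ∀ {f g} h n → (∀ i → f i ≡ g i) → (f ⋆ h) n ≡ (g ⋆ h) n
⋆-congˡ h n f≗g = sumTo-cong n (λ i _ → cong (_* h (n ∸ i)) (f≗g i))

⋆-poly-[] : ∀ f n → (f ⋆ poly []) n ≡ 0ℤ
⋆-poly-[] f n = sumTo-zero n (λ i → *-zeroʳ (f i))

⋆-poly-∷ : ∀ f c cs n → (f ⋆ poly (c ∷ cs)) (suc n) ≡ (f ⋆ poly cs) n + f (suc n) * c
⋆-poly-∷ f c cs n = cong₂ _+_
  (sumTo-cong n (λ i i≤n → cong (λ k → f i * poly (c ∷ cs) k) (+-∸-assoc 1 i≤n)))
  (cong (λ k → f (suc n) * poly (c ∷ cs) k) (n∸n≡0 n))

⋆-poly-[_] : ∀ c f n → (f ⋆ poly (c ∷ [])) n ≡ f n * c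
⋆-poly-[ c ] f zero    = refl
⋆-poly-[ c ] f (suc n) =
  trans (⋆-poly-∷ f c [] n) (trans (cong (_+ f (suc n) * c) (⋆-poly-[] f n)) (+-identityˡ _))

windowSum : Series → ℤ → List ℤ → ℕ → ℤ
windowSum f c []        n = f n * c
windowSum f c (c′ ∷ cs) n = windowSum f c′ cs n + f (suc (length cs ℕ.+ n)) * c

⋆-poly-window : ∀ f c cs n → (f ⋆ poly (c ∷ cs)) (length cs ℕ.+ n) ≡ windowSum f c cs n
⋆-poly-window f c []        n = ⋆-poly-[ c ] f n
⋆-poly-window f c (c′ ∷ cs) n =
  trans (⋆-poly-∷ f c (c′ ∷ cs) (length cs ℕ.+ n)) (cong (_+ _) (⋆-poly-window f c′ cs n))

⋆denom≡numer : ∀ d z (f : Series) →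
  f 0 ≡ 1ℤ → f 1 ≡ f 0 + d → f 2 ≡ f 1 + d → f 3 ≡ f 2 + (d * f 0 + d * d) → f 4 ≡ f 3 + (d * f 1 + d * d) →
  (∀ n → f (5 ℕ.+ n) ≡ f (4 ℕ.+ n) + z * f (3 ℕ.+ n) + (d - z) * f (2 ℕ.+ n) + d * (d - z) * f n) →
  ∀ n → (f ⋆ denom d z) n ≡ numer d z n
⋆denom≡numer d z f f₀ f₁ f₂ f₃ f₄ rec = λ where
    0 → trans (*-identityʳ (f 0)) f₀
    1 → coeff₁ (f 0) (f 1) f₁
    2 → coeff₂ (f 0) (f 1) (f 2) f₀ f₁ f₂
    3 → coeff₃ (f 0) (f 1) (f 2) (f 3) f₁ f₂ f₃
    4 → coeff₄ (f 0) (f 1) (f 2) (f 3) (f 4) f₂ f₄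
    (suc (suc (suc (suc (suc m))))) →
      trans (⋆-poly-window f 1ℤ (- 1ℤ ∷ - z ∷ - (d - z) ∷ 0ℤ ∷ - (d * (d - z)) ∷ []) m)
            (coeff₅₊ (f m) (f (1 ℕ.+ m)) (f (2 ℕ.+ m)) (f (3 ℕ.+ m)) (f (4 ℕ.+ m)) (f (5 ℕ.+ m)) (rec m))
  where
  -- (f ⋆ denom d z) n unfolds definitionally to the left-hand sides below, which the solver needs spelt out.
  coeff₁ : ∀ f₀ f₁ → f₁ ≡ f₀ + d → f₀ * - 1ℤ + f₁ * 1ℤ ≡ d
  coeff₁ f₀ _ refl = solve (d ∷ f₀ ∷ [])
  coeff₂ : ∀ f₀ f₁ f₂ → f₀ ≡ 1ℤ → f₁ ≡ f₀ + d → f₂ ≡ f₁ + d → (f₀ * - z + f₁ * - 1ℤ) + f₂ * 1ℤ ≡ d - z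
  coeff₂ _ _ _ refl refl refl = solve (d ∷ z ∷ [])
  coeff₃ : ∀ f₀ f₁ f₂ f₃ → f₁ ≡ f₀ + d → f₂ ≡ f₁ + d → f₃ ≡ f₂ + (d * f₀ + d * d) →
           ((f₀ * - (d - z) + f₁ * - z) + f₂ * - 1ℤ) + f₃ * 1ℤ ≡ d * (d - z)
  coeff₃ f₀ _ _ _ refl refl refl = solve (d ∷ z ∷ f₀ ∷ [])
  coeff₄ : ∀ f₀ f₁ f₂ f₃ f₄ → f₂ ≡ f₁ + d → f₄ ≡ f₃ + (d * f₁ + d * d) →
           (((f₀ * 0ℤ + f₁ * - (d - z)) + f₂ * - z) + f₃ * - 1ℤ) + f₄ * 1ℤ ≡ d * (d - z)
  coeff₄ f₀ f₁ _ f₃ _ refl refl = solve (d ∷ z ∷ f₀ ∷ f₁ ∷ f₃ ∷ [])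
  coeff₅₊ : ∀ f₀ f₁ f₂ f₃ f₄ f₅ → f₅ ≡ f₄ + z * f₃ + (d - z) * f₂ + d * (d - z) * f₀ →
            ((((f₀ * - (d * (d - z)) + f₁ * 0ℤ) + f₂ * - (d - z)) + f₃ * - z) + f₄ * - 1ℤ) + f₅ * 1ℤ ≡ 0ℤ
  coeff₅₊ f₀ f₁ f₂ f₃ f₄ _ refl = solve (d ∷ z ∷ f₀ ∷ f₁ ∷ f₂ ∷ f₃ ∷ f₄ ∷ [])

mainTheorem3 : (d z : ℤ) → (n : ℕ) → (coeff d z ⋆ denom d z) n ≡ numer d z n
mainTheorem3 d z n = begin
  (coeff d z ⋆ denom d z) n ≡⟨ ⋆-congˡ (denom d z) n coeff≡sumStrings ⟩
  (F ⋆ denom d z) n         ≡⟨ ⋆denom≡numer d z F refl F-1 F-2 F-3 F-4 F-recurrence n ⟩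
  numer d z n               ∎
  where open WeightedCount d z
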